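{- Define polynomials $\lambda_n(x)$ by $\lambda_0(x)=1$ and $\lambda_{n+1}(x)=x\lambda_n(x)-\lambda_n(x+1)$. Then for each $n\geq 0$, \[B^{\pm}(n+j)=\sum_{k=0}^{j}(-1)^k\lambda_n(k)S(j,k)\quad\text{for all } j\geq 0.\] In particular, $B^{\pm}(n)=\lambda_n(0)$.
   Context: $S(n,k)$ denotes the Stirling numbers of the second kind (with $S(0,0)=1$, $S(j,0)=0$ for $j>0$) and $B^{\pm}(n)=\sum_{k=0}^n(-1)^kS(n,k)$. -}

module Defs where

open import Data.Nat using (ℕ; zero; suc)
open import Data.Integer using (ℤ; +_; _+_; _-_; _*_; -_)

S : ℕ → ℕ → ℕ
S zero    zero    = 1
S zero    (suc k) = 0
S (suc j) zero    = 0
S (suc j) (suc k) = suc k Data.Nat.* S j (suc k) Data.Nat.+ S j k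

sgn : ℕ → ℤ
sgn zero    = + 1
sgn (suc k) = - sgn k

sumTo : ℕ → (ℕ → ℤ) → ℤ
sumTo zero    f = f 0
sumTo (suc n) f = sumTo n f + f (suc n)

Bpm : ℕ → ℤ
Bpm n = sumTo n (λ k → sgn k * + S n k)

lam : ℕ → ℤ → ℤ
lam zero    x = + 1
lam (suc n) x = x * lam n x - lam n (x + + 1)

-- Write T_j f = Σ_k (-1)^k f(k) S(j,k). Splitting S(j+1,k) by the Stirling recurrence and
-- reindexing the part coming from S(j,k-1) gives T_{j+1} f = T_j (x ↦ x f(x) - f(x+1)), and
-- λ_{n+1} is exactly this operator applied to λ_n. Since B^±(m) = T_m 1, peeling one step at a
-- time gives B^±(n+j) = T_{n+j} λ_0 = T_j λ_n, and j = 0 yields B^±(n) = λ_n(0).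
module Submission where

open import Defs
open import Data.Nat using (ℕ; _+_; zero; suc; _<_; s≤s)
import Data.Nat as ℕ
import Data.Nat.Properties as ℕ
open import Data.Integer using (ℤ; +_; _*_; -_; _-_)
import Data.Integer as ℤ
import Data.Integer.Properties as ℤ
open import Data.Integer.Tactic.RingSolver using (solve-∀)
open import Data.Product using (_×_; _,_)
open import Relation.Binary.PropositionalEquality
open ≡-Reasoning

S-above-diagonal : ∀ {j k} → j < k → S j k ≡ 0
S-above-diagonal {zero}  {suc k}       _       = refl
S-above-diagonal {suc j} {suc (suc k)} (s≤s p) = begin
  suc (suc k) ℕ.* S j (suc (suc k)) ℕ.+ S j (suc k)
    ≡⟨ cong₂ (λ a b → suc (suc k) ℕ.* a ℕ.+ b)
             (S-above-diagonal (ℕ.m<n⇒m<1+n p)) (S-above-diagonal p) ⟩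
  suc (suc k) ℕ.* 0 ℕ.+ 0
    ≡⟨ cong (ℕ._+ 0) (ℕ.*-zeroʳ (suc (suc k))) ⟩
  0 ∎

sumTo-cong : ∀ n {f g : ℕ → ℤ} → (∀ k → f k ≡ g k) → sumTo n f ≡ sumTo n g
sumTo-cong zero    f≗g = f≗g 0
sumTo-cong (suc n) f≗g = cong₂ ℤ._+_ (sumTo-cong n f≗g) (f≗g (suc n))

sumTo-+ : ∀ n (f g : ℕ → ℤ) → sumTo n (λ k → f k ℤ.+ g k) ≡ sumTo n f ℤ.+ sumTo n g
sumTo-+ zero    f g = refl
sumTo-+ (suc n) f g = begin
  sumTo n (λ k → f k ℤ.+ g k) ℤ.+ (f (suc n) ℤ.+ g (suc n))
    ≡⟨ cong (ℤ._+ (f (suc n) ℤ.+ g (suc n))) (sumTo-+ n f g) ⟩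
  (sumTo n f ℤ.+ sumTo n g) ℤ.+ (f (suc n) ℤ.+ g (suc n))
    ≡⟨ interchange (sumTo n f) (sumTo n g) (f (suc n)) (g (suc n)) ⟩
  (sumTo n f ℤ.+ f (suc n)) ℤ.+ (sumTo n g ℤ.+ g (suc n)) ∎
  where
  interchange : ∀ a b c d → (a ℤ.+ b) ℤ.+ (c ℤ.+ d) ≡ (a ℤ.+ c) ℤ.+ (b ℤ.+ d)
  interchange = solve-∀

sumTo-suc-head : ∀ n (f : ℕ → ℤ) → sumTo (suc n) f ≡ f 0 ℤ.+ sumTo n (λ k → f (suc k))
sumTo-suc-head zero    f = refl
sumTo-suc-head (suc n) f = begin
  sumTo (suc n) f ℤ.+ f (suc (suc n))
    ≡⟨ cong (ℤ._+ f (suc (suc n))) (sumTo-suc-head n f) ⟩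
  (f 0 ℤ.+ sumTo n (λ k → f (suc k))) ℤ.+ f (suc (suc n))
    ≡⟨ ℤ.+-assoc (f 0) _ _ ⟩
  f 0 ℤ.+ (sumTo n (λ k → f (suc k)) ℤ.+ f (suc (suc n))) ∎

sumTo-reindex-suc : ∀ n (f : ℕ → ℤ) → f 0 ≡ + 0 → f (suc n) ≡ + 0 →
                    sumTo n (λ k → f (suc k)) ≡ sumTo n f
sumTo-reindex-suc n f f0≡0 f[1+n]≡0 = begin
  sumTo n (λ k → f (suc k))            ≡⟨ sym (ℤ.+-identityˡ _) ⟩
  + 0 ℤ.+ sumTo n (λ k → f (suc k))    ≡⟨ cong (ℤ._+ sumTo n (λ k → f (suc k))) (sym f0≡0) ⟩
  f 0 ℤ.+ sumTo n (λ k → f (suc k))    ≡⟨ sym (sumTo-suc-head n f) ⟩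
  sumTo n f ℤ.+ f (suc n)              ≡⟨ cong (λ z → sumTo n f ℤ.+ z) f[1+n]≡0 ⟩
  sumTo n f ℤ.+ + 0                    ≡⟨ ℤ.+-identityʳ _ ⟩
  sumTo n f ∎

alternatingStirling : ℕ → (ℤ → ℤ) → ℤ
alternatingStirling j f = sumTo j (λ k → sgn k * f (+ k) * + S j k)

step : (ℤ → ℤ) → ℤ → ℤ
step f x = x * f x - f (x ℤ.+ + 1)

alternatingStirling-suc : ∀ j (f : ℤ → ℤ) →
  alternatingStirling (suc j) f ≡ alternatingStirling j (step f)
alternatingStirling-suc j f = begin
  sumTo (suc j) term
    ≡⟨ sumTo-suc-head j term ⟩
  term 0 ℤ.+ sumTo j (λ k → term (suc k))
    ≡⟨ cong₂ ℤ._+_ term0≡0 (sumTo-cong j term-suc) ⟩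
  + 0 ℤ.+ sumTo j (λ k → diag (suc k) ℤ.+ sub k)
    ≡⟨ ℤ.+-identityˡ _ ⟩
  sumTo j (λ k → diag (suc k) ℤ.+ sub k)
    ≡⟨ sumTo-+ j _ _ ⟩
  sumTo j (λ k → diag (suc k)) ℤ.+ sumTo j sub
    ≡⟨ cong (ℤ._+ sumTo j sub) (sumTo-reindex-suc j diag diag0≡0 diag-end≡0) ⟩
  sumTo j diag ℤ.+ sumTo j sub
    ≡⟨ sym (sumTo-+ j diag sub) ⟩
  sumTo j (λ k → diag k ℤ.+ sub k)
    ≡⟨ sumTo-cong j combine ⟩
  alternatingStirling j (step f) ∎
  where
  term diag sub : ℕ → ℤ
  term k = sgn k * f (+ k) * + S (suc j) k
  diag k = sgn k * f (+ k) * (+ k * + S j k)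
  sub  k = sgn (suc k) * f (+ k ℤ.+ + 1) * + S j k

  term0≡0 : term 0 ≡ + 0
  term0≡0 = ℤ.*-zeroʳ (sgn 0 * f (+ 0))

  diag0≡0 : diag 0 ≡ + 0
  diag0≡0 = trans (cong (sgn 0 * f (+ 0) *_) (ℤ.*-zeroˡ (+ S j 0))) (ℤ.*-zeroʳ (sgn 0 * f (+ 0)))

  diag-end≡0 : diag (suc j) ≡ + 0
  diag-end≡0 = begin
    sgn (suc j) * f (+ suc j) * (+ suc j * + S j (suc j))
      ≡⟨ cong (λ s → sgn (suc j) * f (+ suc j) * (+ suc j * + s)) (S-above-diagonal (ℕ.n<1+n j)) ⟩
    sgn (suc j) * f (+ suc j) * (+ suc j * + 0)
      ≡⟨ cong (sgn (suc j) * f (+ suc j) *_) (ℤ.*-zeroʳ (+ suc j)) ⟩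
    sgn (suc j) * f (+ suc j) * + 0
      ≡⟨ ℤ.*-zeroʳ (sgn (suc j) * f (+ suc j)) ⟩
    + 0 ∎

  term-suc : ∀ k → term (suc k) ≡ diag (suc k) ℤ.+ sub k
  term-suc k = begin
    sgn (suc k) * f (+ suc k) * + (suc k ℕ.* S j (suc k) ℕ.+ S j k)
      ≡⟨ cong (sgn (suc k) * f (+ suc k) *_)
              (trans (ℤ.pos-+ _ (S j k)) (cong (ℤ._+ + S j k) (ℤ.pos-* (suc k) (S j (suc k))))) ⟩
    sgn (suc k) * f (+ suc k) * (+ suc k * + S j (suc k) ℤ.+ + S j k)
      ≡⟨ ℤ.*-distribˡ-+ (sgn (suc k) * f (+ suc k)) _ _ ⟩
    diag (suc k) ℤ.+ sgn (suc k) * f (+ suc k) * + S j k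
      ≡⟨ cong (λ n → diag (suc k) ℤ.+ sgn (suc k) * f (+ n) * + S j k) (ℕ.+-comm 1 k) ⟩
    diag (suc k) ℤ.+ sub k ∎

  -- sgn (suc k) reduces to - sgn k, so this is a ring identity.
  combine : ∀ k → diag k ℤ.+ sub k ≡ sgn k * step f (+ k) * + S j k
  combine k = identity (sgn k) (f (+ k)) (f (+ k ℤ.+ + 1)) (+ k) (+ S j k)
    where
    identity : ∀ s a b x y → s * a * (x * y) ℤ.+ (- s) * b * y ≡ s * (x * a - b) * y
    identity = solve-∀

Bpm-alternatingStirling : ∀ m → Bpm m ≡ alternatingStirling m (λ _ → + 1)
Bpm-alternatingStirling m = sumTo-cong m (λ k → cong (_* + S m k) (sym (ℤ.*-identityʳ (sgn k))))

Bpm-+ : ∀ n j → Bpm (n + j) ≡ alternatingStirling j (lam n)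
Bpm-+ zero    j = Bpm-alternatingStirling j
Bpm-+ (suc n) j = begin
  Bpm (suc n + j)                       ≡⟨ cong Bpm (sym (ℕ.+-suc n j)) ⟩
  Bpm (n + suc j)                       ≡⟨ Bpm-+ n (suc j) ⟩
  alternatingStirling (suc j) (lam n)   ≡⟨ alternatingStirling-suc j (lam n) ⟩
  alternatingStirling j (lam (suc n))   ∎

lemma2p1 : (n : ℕ) →
    ((j : ℕ) → Bpm (n + j) ≡ sumTo j (λ k → sgn k * lam n (+ k) * + S j k))
    × (Bpm n ≡ lam n (+ 0))
lemma2p1 n = Bpm-+ n , (begin
  Bpm n                    ≡⟨ cong Bpm (sym (ℕ.+-identityʳ n)) ⟩
  Bpm (n + 0)              ≡⟨ Bpm-+ n 0 ⟩
  + 1 * lam n (+ 0) * + 1  ≡⟨ ℤ.*-identityʳ _ ⟩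
  + 1 * lam n (+ 0)        ≡⟨ ℤ.*-identityˡ _ ⟩
  lam n (+ 0)              ∎)
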